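{- Let $\varphi:\{a,b\}^*\to\{a,b\}^*$ be the morphism $\varphi(a)=abbabba$, $\varphi(b)=aba$, let $\mathbf{u}$ be its fixed point (starting with $a$), let $\Psi:\{a,b\}^*\to\{0,1,2\}^*$ be the morphism $\Psi(a)=12$, $\Psi(b)=100$, let $\mathbf{v}=\Psi(\mathbf{u})$, and define $H(w)=\Psi(w)1$ for $w\in\{a,b\}^*$. Then for every $w\in\{a,b\}^*$: (a) if $w$ is a factor of $\mathbf{u}$, then $H(w)$ is a factor of $\mathbf{v}$; (b) if $w$ is a palindrome, then $H(w)$ is a palindrome; (c) if $w$ is a factor of $\mathbf{u}$, then $b(w)=b(H(w))$, where the bilateral order of $w$ is computed in $\mathbf{u}$ and that of $H(w)$ in $\mathbf{v}$.
   Context: For an infinite word $\mathbf{x}$ with language $\mathcal{L}(\mathbf{x})$ (its set of finite factors) and a factor $w$, $\mathrm{Lext}(w)=\{c: cw\in\mathcal{L}(\mathbf{x})\}$, $\mathrm{Rext}(w)=\{c: wc\in\mathcal{L}(\mathbf{x})\}$, and the bilateral order is $b(w)=\#\{(c,d): cwd\in\mathcal{L}(\mathbf{x})\}-\#\mathrm{Lext}(w)-\#\mathrm{Rext}(w)+1$. A palindrome is a word equal to its reversal. -}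

module Defs where

open import Data.Nat using (ℕ; zero; suc; _+_)
open import Data.Integer using (ℤ; +_; _-_)
open import Data.List using (List; []; _∷_; _++_; [_]; length; concatMap; reverse)
open import Data.List.Membership.Propositional using (_∈_)
open import Data.List.Relation.Unary.Unique.Propositional using (Unique)
open import Data.Product using (Σ; ∃; _×_; _,_)
open import Data.Unit using (⊤)
open import Function.Bundles using (_⇔_)
open import Relation.Binary.PropositionalEquality using (_≡_)

data AB : Set where
  a b : AB

data D3 : Set where
  d0 d1 d2 : D3

InfWord : Set → Set
InfWord A = ℕ → A

-- n-th letter of a finite word, with a default letter (only used where the index is in range)
nth : {A : Set} → List A → ℕ → A → A
nth []       _       d = d
nth (x ∷ _)  zero    _ = x
nth (_ ∷ xs) (suc i) d = nth xs i d

φ₁ : AB → List AB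
φ₁ a = a ∷ b ∷ b ∷ a ∷ b ∷ b ∷ a ∷ []
φ₁ b = a ∷ b ∷ a ∷ []

φ : List AB → List AB
φ = concatMap φ₁

Ψ₁ : AB → List D3
Ψ₁ a = d1 ∷ d2 ∷ []
Ψ₁ b = d1 ∷ d0 ∷ d0 ∷ []

Ψ : List AB → List D3
Ψ = concatMap Ψ₁

φ^ : ℕ → List AB → List AB
φ^ zero    w = w
φ^ (suc n) w = φ (φ^ n w)

-- The fixed point u = lim φⁿ(a): since φ(a) starts with a, φⁿ(a) is a prefix of u,
-- and |φ^(i+1)(a)| > i, so the i-th letter of u is the i-th letter of φ^(i+1)(a).
u : InfWord AB
u i = nth (φ^ (suc i) [ a ]) i a

-- v = Ψ(u): Ψ(φ^(i+1)(a)) is a prefix of Ψ(u) of length > i.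
v : InfWord D3
v i = nth (Ψ (φ^ (suc i) [ a ])) i d0

H : List AB → List D3
H w = Ψ w ++ [ d1 ]

OccursAt : {A : Set} → InfWord A → ℕ → List A → Set
OccursAt x i []      = ⊤
OccursAt x i (c ∷ w) = x i ≡ c × OccursAt x (suc i) w

Factor : {A : Set} → InfWord A → List A → Set
Factor x w = ∃ λ i → OccursAt x i w

Palindrome : {A : Set} → List A → Set
Palindrome w = w ≡ reverse w

HasCard : {A : Set} → (A → Set) → ℕ → Set
HasCard {A} P n = Σ (List A) λ l → Unique l × (∀ y → (y ∈ l) ⇔ P y) × length l ≡ n

Lext : {A : Set} → InfWord A → List A → A → Set
Lext x w c = Factor x (c ∷ w)

Rext : {A : Set} → InfWord A → List A → A → Set
Rext x w c = Factor x (w ++ [ c ])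

BiExt : {A : Set} → InfWord A → List A → A × A → Set
BiExt x w (c , d) = Factor x (c ∷ w ++ [ d ])

BilateralOrder : {A : Set} → InfWord A → List A → ℤ → Set
BilateralOrder x w k =
  ∃ λ nB → ∃ λ nL → ∃ λ nR →
    HasCard (BiExt x w) nB × HasCard (Lext x w) nL × HasCard (Rext x w) nR ×
    k ≡ (+ nB - + nL - + nR) Data.Integer.+ + 1

-- Ψ codes a letter c as a block Ψ(c) = 1 σ(c)…σ(c), with σ(a) = 2 and σ(b) = 0, and
-- the letter 1 of v occurs only at block starts. Hence the occurrences of H(w) = Ψ(w)1
-- in v are exactly the images of the occurrences of w in u, and the letters just
-- before and after such an occurrence are σ of the letters just before and after w.
-- So the left, right and bilateral extensions of w and of H(w) correspond under the
-- injective σ, and all three cardinalities in b(w) are preserved. Palindromicity is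
-- preserved because H(w) = 1 Ψ′(w) for the morphism Ψ′ whose images are the reversals
-- of those of Ψ.
module Submission where

open import Defs
open import Data.Nat using (ℕ; zero; suc; _+_; _≤_; _<_; z≤n; s≤s)
open import Data.Nat.Properties
  using (≤-trans; ≤-total; +-suc; +-identityʳ; +-assoc; +-comm; +-mono-≤; m≤m+n; m≤n+m;
         n≤1+n; m≤n⇒m<n∨m≡n; suc-injective; module ≤-Reasoning)
open import Data.List using (List; []; _∷_; _++_; [_]; length; map; reverse; concatMap)
open import Data.List.Properties
  using (length-map; length-++; ++-assoc; ++-identityʳ; concatMap-++; concatMap-cong;
         reverse-++; unfold-reverse)
open import Data.List.Membership.Propositional using (_∈_)
open import Data.List.Membership.Propositional.Properties using (∈-map⁺; ∈-map⁻)
open import Data.List.Membership.Propositional.Properties.WithK using (unique∧set⇒bag)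
open import Data.List.Relation.Binary.BagAndSetEquality using (∼bag⇒↭)
open import Data.List.Relation.Binary.Permutation.Propositional.Properties using (↭-length)
open import Data.List.Relation.Unary.Unique.Propositional.Properties using (map⁺)
open import Data.Integer using (ℤ)
open import Data.Product using (∃; _×_; _,_; proj₁)
import Data.Product as Product
open import Data.Product.Properties using (,-injectiveˡ; ,-injectiveʳ)
open import Data.Sum using (inj₁; inj₂)
open import Data.Unit using (tt)
open import Function using (_∘_)
open import Function.Bundles using (Equivalence; mk⇔)
open import Function.Definitions using (Injective)
open import Relation.Binary.PropositionalEquality
  using (_≡_; refl; sym; trans; cong; cong₂; subst; module ≡-Reasoning)

HasCard-injective-image : {A B : Set} {P : A → Set} {Q : B → Set} (g : A → B) →
  Injective _≡_ _≡_ g → (∀ {c} → P c → Q (g c)) → (∀ {e} → Q e → ∃ λ c → g c ≡ e × P c) →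
  ∀ {n m} → HasCard P n → HasCard Q m → n ≡ m
HasCard-injective-image g g-injective P⇒Q Q⇒P
                        (xs , xs-unique , ∈xs⇔P , refl) (ys , ys-unique , ∈ys⇔Q , refl) =
  begin
    length xs          ≡⟨ sym (length-map g xs) ⟩
    length (map g xs)  ≡⟨ ↭-length (∼bag⇒↭ (unique∧set⇒bag (map⁺ g-injective xs-unique) ys-unique
                                                           (mk⇔ image⊆ys ys⊆image))) ⟩
    length ys          ∎
  where
  open ≡-Reasoning
  image⊆ys : ∀ {e} → e ∈ map g xs → e ∈ ys
  image⊆ys e∈ with ∈-map⁻ g e∈
  ... | c , c∈xs , refl = Equivalence.from (∈ys⇔Q (g c)) (P⇒Q (Equivalence.to (∈xs⇔P c) c∈xs))
  ys⊆image : ∀ {e} → e ∈ ys → e ∈ map g xs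
  ys⊆image {e} e∈ with Q⇒P (Equivalence.to (∈ys⇔Q e) e∈)
  ... | c , refl , Pc = ∈-map⁺ g (Equivalence.from (∈xs⇔P c) Pc)

reverse-concatMap : {A B : Set} (f : A → List B) (xs : List A) →
  reverse (concatMap f xs) ≡ concatMap (reverse ∘ f) (reverse xs)
reverse-concatMap f [] = refl
reverse-concatMap f (x ∷ xs) = begin
    reverse (f x ++ concatMap f xs)                        ≡⟨ reverse-++ (f x) (concatMap f xs) ⟩
    reverse (concatMap f xs) ++ reverse (f x)              ≡⟨ cong (_++ reverse (f x)) (reverse-concatMap f xs) ⟩
    concatMap (reverse ∘ f) (reverse xs) ++ reverse (f x)  ≡⟨ cong (concatMap (reverse ∘ f) (reverse xs) ++_)
                                                                   (sym (++-identityʳ (reverse (f x)))) ⟩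
    concatMap (reverse ∘ f) (reverse xs) ++ concatMap (reverse ∘ f) [ x ]
                                                           ≡⟨ sym (concatMap-++ (reverse ∘ f) (reverse xs) [ x ]) ⟩
    concatMap (reverse ∘ f) (reverse xs ++ [ x ])          ≡⟨ cong (concatMap (reverse ∘ f)) (sym (unfold-reverse x xs)) ⟩
    concatMap (reverse ∘ f) (reverse (x ∷ xs))             ∎
  where open ≡-Reasoning

Ψ₁′ : AB → List D3
Ψ₁′ a = d2 ∷ d1 ∷ []
Ψ₁′ b = d0 ∷ d0 ∷ d1 ∷ []

reverse-Ψ₁′ : ∀ c → reverse (Ψ₁′ c) ≡ Ψ₁ c
reverse-Ψ₁′ a = refl
reverse-Ψ₁′ b = refl

H-conjugate : ∀ w → H w ≡ d1 ∷ concatMap Ψ₁′ w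
H-conjugate []      = refl
H-conjugate (a ∷ w) = cong (λ z → d1 ∷ d2 ∷ z) (H-conjugate w)
H-conjugate (b ∷ w) = cong (λ z → d1 ∷ d0 ∷ d0 ∷ z) (H-conjugate w)

reverse-H : ∀ w → reverse (H w) ≡ H (reverse w)
reverse-H w = begin
    reverse (H w)                                    ≡⟨ cong reverse (H-conjugate w) ⟩
    reverse (d1 ∷ concatMap Ψ₁′ w)                   ≡⟨ unfold-reverse d1 (concatMap Ψ₁′ w) ⟩
    reverse (concatMap Ψ₁′ w) ++ [ d1 ]              ≡⟨ cong (_++ [ d1 ]) (reverse-concatMap Ψ₁′ w) ⟩
    concatMap (reverse ∘ Ψ₁′) (reverse w) ++ [ d1 ]  ≡⟨ cong (_++ [ d1 ]) (concatMap-cong reverse-Ψ₁′ (reverse w)) ⟩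
    H (reverse w)                                    ∎
  where open ≡-Reasoning

H-palindrome : ∀ w → Palindrome w → Palindrome (H w)
H-palindrome w w≡rev = trans (cong H w≡rev) (sym (reverse-H w))

module _ {A : Set} (x : InfWord A) where

  OccursAt-++⁺ : ∀ xs ys i → OccursAt x i xs → OccursAt x (i + length xs) ys → OccursAt x i (xs ++ ys)
  OccursAt-++⁺ []       ys i _        o = subst (λ j → OccursAt x j ys) (+-identityʳ i) o
  OccursAt-++⁺ (c ∷ xs) ys i (e , o₁) o₂ =
    e , OccursAt-++⁺ xs ys (suc i) o₁ (subst (λ j → OccursAt x j ys) (+-suc i (length xs)) o₂)

  OccursAt-++⁻ : ∀ xs ys i → OccursAt x i (xs ++ ys) → OccursAt x i xs × OccursAt x (i + length xs) ys
  OccursAt-++⁻ []       ys i o       = tt , subst (λ j → OccursAt x j ys) (sym (+-identityʳ i)) o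
  OccursAt-++⁻ (c ∷ xs) ys i (e , o) with OccursAt-++⁻ xs ys (suc i) o
  ... | o₁ , o₂ = (e , o₁) , subst (λ j → OccursAt x j ys) (sym (+-suc i (length xs))) o₂

  OccursAt-nth : ∀ xs i t d → OccursAt x i xs → t < length xs → x (i + t) ≡ nth xs t d
  OccursAt-nth (c ∷ xs) i zero    d (e , _) _         = trans (cong x (+-identityʳ i)) e
  OccursAt-nth (c ∷ xs) i (suc t) d (_ , o) (s≤s t<) =
    trans (cong x (+-suc i t)) (OccursAt-nth xs (suc i) t d o t<)

  OccursAt-from-nth : ∀ xs i d → (∀ t → t < length xs → x (i + t) ≡ nth xs t d) → OccursAt x i xs
  OccursAt-from-nth []       i d _     = tt
  OccursAt-from-nth (c ∷ xs) i d agree =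
    trans (sym (cong x (+-identityʳ i))) (agree 0 (s≤s z≤n)) ,
    OccursAt-from-nth xs (suc i) d λ t t< → trans (sym (cong x (+-suc i t))) (agree (suc t) (s≤s t<))

_≼_ : {A : Set} → List A → List A → Set
xs ≼ ys = ∃ λ r → xs ++ r ≡ ys

module _ {A : Set} where

  ≼-refl : {xs : List A} → xs ≼ xs
  ≼-refl {xs} = [] , ++-identityʳ xs

  ≼-trans : {xs ys zs : List A} → xs ≼ ys → ys ≼ zs → xs ≼ zs
  ≼-trans {xs} (r , refl) (s , refl) = r ++ s , sym (++-assoc xs r s)

  nth-≼ : {xs ys : List A} (t : ℕ) (d : A) → xs ≼ ys → t < length xs → nth ys t d ≡ nth xs t d
  nth-≼ {c ∷ xs} zero    d (r , refl) _        = refl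
  nth-≼ {c ∷ xs} (suc t) d (r , refl) (s≤s t<) = nth-≼ {xs} t d (r , refl) t<

  concatMap-≼ : {B : Set} (f : A → List B) {xs ys : List A} → xs ≼ ys → concatMap f xs ≼ concatMap f ys
  concatMap-≼ f {xs} (r , refl) = concatMap f r , sym (concatMap-++ f xs r)

  length-concatMap-≥ : {B : Set} (f : A → List B) → (∀ c → 2 ≤ length (f c)) →
    ∀ xs → length xs + length xs ≤ length (concatMap f xs)
  length-concatMap-≥ f long [] = z≤n
  length-concatMap-≥ f long (c ∷ xs) = begin
      suc (length xs) + suc (length xs)       ≡⟨ cong suc (+-suc (length xs) (length xs)) ⟩
      2 + (length xs + length xs)             ≤⟨ +-mono-≤ (long c) (length-concatMap-≥ f long xs) ⟩
      length (f c) + length (concatMap f xs)  ≡⟨ sym (length-++ (f c)) ⟩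
      length (concatMap f (c ∷ xs))           ∎
    where open ≤-Reasoning

module _ {A : Set} (F : ℕ → List A) (F-grows : ∀ n → F n ≼ F (suc n)) where

  chain-≼ : ∀ {m n} → m ≤ n → F m ≼ F n
  chain-≼ {n = zero}  z≤n = ≼-refl
  chain-≼ {n = suc n} m≤1+n with m≤n⇒m<n∨m≡n m≤1+n
  ... | inj₁ (s≤s m≤n) = ≼-trans (chain-≼ m≤n) (F-grows n)
  ... | inj₂ refl      = ≼-refl

  limit-prefix : (d : A) → (∀ i → i < length (F (suc i))) →
    ∀ m → OccursAt (λ i → nth (F (suc i)) i d) 0 (F m)
  limit-prefix d long m = OccursAt-from-nth _ (F m) 0 d agree
    where
    agree : ∀ i → i < length (F m) → nth (F (suc i)) i d ≡ nth (F m) i d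
    agree i i< with ≤-total m (suc i)
    ... | inj₁ m≤ = nth-≼ i d (chain-≼ m≤) i<
    ... | inj₂ ≥m = sym (nth-≼ i d (chain-≼ ≥m) (long i))

Φ : ℕ → List AB
Φ n = φ^ n [ a ]

Φ-grows : ∀ n → Φ n ≼ Φ (suc n)
Φ-grows zero    = b ∷ b ∷ a ∷ b ∷ b ∷ a ∷ [] , refl
Φ-grows (suc n) = concatMap-≼ φ₁ (Φ-grows n)

φ₁-long : ∀ c → 2 ≤ length (φ₁ c)
φ₁-long a = s≤s (s≤s z≤n)
φ₁-long b = s≤s (s≤s z≤n)

Ψ₁-long : ∀ c → 2 ≤ length (Ψ₁ c)
Ψ₁-long a = s≤s (s≤s z≤n)
Ψ₁-long b = s≤s (s≤s z≤n)

length-Φ : ∀ n → suc n ≤ length (Φ n)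
length-Φ zero    = s≤s z≤n
length-Φ (suc n) = begin
    suc (suc n)                  ≤⟨ s≤s (m≤n+m (suc n) n) ⟩
    suc n + suc n                ≤⟨ +-mono-≤ (length-Φ n) (length-Φ n) ⟩
    length (Φ n) + length (Φ n)  ≤⟨ length-concatMap-≥ φ₁ φ₁-long (Φ n) ⟩
    length (Φ (suc n))           ∎
  where open ≤-Reasoning

Φ-long : ∀ i → i < length (Φ (suc i))
Φ-long i = ≤-trans (n≤1+n (suc i)) (length-Φ (suc i))

u-prefix : ∀ m → OccursAt u 0 (Φ m)
u-prefix = limit-prefix Φ Φ-grows a Φ-long

v-prefix : ∀ m → OccursAt v 0 (Ψ (Φ m))
v-prefix = limit-prefix (Ψ ∘ Φ) (concatMap-≼ Ψ₁ ∘ Φ-grows) d0 λ i →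
  ≤-trans (Φ-long i) (≤-trans (m≤m+n _ _) (length-concatMap-≥ Ψ₁ Ψ₁-long (Φ (suc i))))

blockStart : InfWord AB → ℕ → ℕ
blockStart x zero    = 0
blockStart x (suc j) = blockStart x j + length (Ψ₁ (x j))

IsΨImage : InfWord AB → InfWord D3 → Set
IsΨImage x y = ∀ j → OccursAt y (blockStart x j) (Ψ₁ (x j))

blockStart-+ : ∀ {x} w i → OccursAt x i w → blockStart x (i + length w) ≡ blockStart x i + length (Ψ w)
blockStart-+ {x} [] i _ = trans (cong (blockStart x) (+-identityʳ i)) (sym (+-identityʳ _))
blockStart-+ {x} (c ∷ w) i (refl , o) = begin
    blockStart x (i + suc (length w))                   ≡⟨ cong (blockStart x) (+-suc i (length w)) ⟩
    blockStart x (suc i + length w)                     ≡⟨ blockStart-+ w (suc i) o ⟩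
    blockStart x i + length (Ψ₁ c) + length (Ψ w)       ≡⟨ +-assoc (blockStart x i) (length (Ψ₁ c)) _ ⟩
    blockStart x i + (length (Ψ₁ c) + length (Ψ w))     ≡⟨ cong (blockStart x i +_) (sym (length-++ (Ψ₁ c))) ⟩
    blockStart x i + length (Ψ (c ∷ w))                 ∎
  where open ≡-Reasoning

prefix-blocks : ∀ {x y} L k → OccursAt x k L → OccursAt y (blockStart x k) (Ψ L) →
  ∀ j → j < length L → OccursAt y (blockStart x (k + j)) (Ψ₁ (x (k + j)))
prefix-blocks {x} {y} (c ∷ L) k (refl , ox) oy j j< with OccursAt-++⁻ y (Ψ₁ c) (Ψ L) (blockStart x k) oy
prefix-blocks (c ∷ L) k (refl , ox) oy zero _ | o₁ , _ rewrite +-identityʳ k = o₁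
prefix-blocks (c ∷ L) k (refl , ox) oy (suc j) (s≤s j<) | _ , o₂ rewrite +-suc k j =
  prefix-blocks L (suc k) ox o₂ j j<

v-IsΨImage-u : IsΨImage u v
v-IsΨImage-u j = prefix-blocks (Φ (suc j)) 0 (u-prefix (suc j)) (v-prefix (suc j)) j (Φ-long j)

σ : AB → D3
σ a = d2
σ b = d0

σ-injective : Injective _≡_ _≡_ σ
σ-injective {a} {a} _ = refl
σ-injective {b} {b} _ = refl
σ-injective {a} {b} ()
σ-injective {b} {a} ()

σ×σ-injective : Injective _≡_ _≡_ (Product.map σ σ)
σ×σ-injective {c , d} {c′ , d′} e = cong₂ _,_ (σ-injective (,-injectiveˡ e)) (σ-injective (,-injectiveʳ e))

Ψ₁-nonempty : ∀ c → 0 < length (Ψ₁ c)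
Ψ₁-nonempty c = ≤-trans (n≤1+n 1) (Ψ₁-long c)

Ψ₁-d1-only-at-head : ∀ c t → t < length (Ψ₁ c) → nth (Ψ₁ c) t d0 ≡ d1 → t ≡ 0
Ψ₁-d1-only-at-head c zero          _                     _  = refl
Ψ₁-d1-only-at-head a (suc zero)    _                     ()
Ψ₁-d1-only-at-head a (suc (suc t)) (s≤s (s≤s ()))        _
Ψ₁-d1-only-at-head b (suc zero)    _                     ()
Ψ₁-d1-only-at-head b (suc (suc zero)) _                  ()
Ψ₁-d1-only-at-head b (suc (suc (suc t))) (s≤s (s≤s (s≤s ()))) _

module _ {y : InfWord D3} where

  block-head : ∀ {c S} → OccursAt y S (Ψ₁ c) → y S ≡ d1
  block-head {a} (e , _) = e
  block-head {b} (e , _) = e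

  block-second : ∀ {c S} → OccursAt y S (Ψ₁ c) → y (suc S) ≡ σ c
  block-second {a} (_ , e , _) = e
  block-second {b} (_ , e , _) = e

  block-last : ∀ {c S p} → OccursAt y S (Ψ₁ c) → suc p ≡ S + length (Ψ₁ c) → y p ≡ σ c
  block-last {a} {S} (_ , e , _)     1+p≡ rewrite suc-injective (trans 1+p≡ (+-comm S 2)) = e
  block-last {b} {S} (_ , _ , e , _) 1+p≡ rewrite suc-injective (trans 1+p≡ (+-comm S 3)) = e

blockStart-suc-pred : ∀ x i → ∃ λ p → suc p ≡ blockStart x (suc i)
blockStart-suc-pred x i with length (Ψ₁ (x i)) | Ψ₁-nonempty (x i)
... | suc k | _ = blockStart x i + k , sym (+-suc (blockStart x i) k)

blockStart-cover : ∀ x p → ∃ λ j → ∃ λ t → t < length (Ψ₁ (x j)) × p ≡ blockStart x j + t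
blockStart-cover x zero = 0 , 0 , Ψ₁-nonempty (x 0) , refl
blockStart-cover x (suc p) with blockStart-cover x p
... | j , t , t< , refl with m≤n⇒m<n∨m≡n t<
...   | inj₁ 1+t< = j , suc t , 1+t< , sym (+-suc (blockStart x j) t)
...   | inj₂ 1+t≡ = suc j , 0 , Ψ₁-nonempty (x (suc j)) , (begin
          suc (blockStart x j + t)  ≡⟨ sym (+-suc (blockStart x j) t) ⟩
          blockStart x j + suc t    ≡⟨ cong (blockStart x j +_) 1+t≡ ⟩
          blockStart x (suc j)      ≡⟨ sym (+-identityʳ _) ⟩
          blockStart x (suc j) + 0  ∎)
  where open ≡-Reasoning

module ΨImage {x : InfWord AB} {y : InfWord D3} (y≡Ψx : IsΨImage x y) where

  d1-at-blockStart : ∀ {p} → y p ≡ d1 → ∃ λ j → p ≡ blockStart x j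
  d1-at-blockStart {p} yp≡d1 with blockStart-cover x p
  ... | j , t , t< , refl
    with Ψ₁-d1-only-at-head (x j) t t<
           (trans (sym (OccursAt-nth y (Ψ₁ (x j)) (blockStart x j) t d0 (y≡Ψx j) t<)) yp≡d1)
  ... | refl = j , +-identityʳ _

  Ψ-occurs : ∀ w {i} → OccursAt x i w → OccursAt y (blockStart x i) (Ψ w)
  Ψ-occurs []      _          = tt
  Ψ-occurs (c ∷ w) {i} (refl , o) =
    OccursAt-++⁺ y (Ψ₁ c) (Ψ w) (blockStart x i) (y≡Ψx i) (Ψ-occurs w o)

  Ψ-occurs⁻ : ∀ w {i} → OccursAt y (blockStart x i) (Ψ w) → OccursAt x i w
  Ψ-occurs⁻ []      _ = tt
  Ψ-occurs⁻ (c ∷ w) {i} o with OccursAt-++⁻ y (Ψ₁ c) (Ψ w) (blockStart x i) o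
  ... | o₁ , o₂ with σ-injective (trans (sym (block-second (y≡Ψx i))) (block-second o₁))
  ...   | refl = refl , Ψ-occurs⁻ w o₂

  H-occurs : ∀ w {i} → OccursAt x i w → OccursAt y (blockStart x i) (H w)
  H-occurs w {i} o = OccursAt-++⁺ y (Ψ w) [ d1 ] (blockStart x i) (Ψ-occurs w o)
    (subst (λ p → y p ≡ d1) (blockStart-+ w i o) (block-head (y≡Ψx (i + length w))) , tt)

  H-occurs⁻ : ∀ w {q} → OccursAt y q (H w) → ∃ λ i → q ≡ blockStart x i × OccursAt x i w
  H-occurs⁻ w {q} o with d1-at-blockStart (proj₁ (subst (OccursAt y q) (H-conjugate w) o))
  ... | i , refl = i , refl , Ψ-occurs⁻ w (proj₁ (OccursAt-++⁻ y (Ψ w) [ d1 ] (blockStart x i) o))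

  letter-after-H : ∀ w {i} → OccursAt x i w → y (blockStart x i + length (H w)) ≡ σ (x (i + length w))
  letter-after-H w {i} o =
    subst (λ p → y p ≡ σ (x (i + length w))) (sym H-end) (block-second (y≡Ψx (i + length w)))
    where
    open ≡-Reasoning
    H-end : blockStart x i + length (H w) ≡ suc (blockStart x (i + length w))
    H-end = begin
      blockStart x i + length (Ψ w ++ [ d1 ])   ≡⟨ cong (blockStart x i +_) (length-++ (Ψ w)) ⟩
      blockStart x i + (length (Ψ w) + 1)       ≡⟨ sym (+-assoc (blockStart x i) (length (Ψ w)) 1) ⟩
      blockStart x i + length (Ψ w) + 1         ≡⟨ +-comm _ 1 ⟩
      suc (blockStart x i + length (Ψ w))       ≡⟨ cong suc (sym (blockStart-+ w i o)) ⟩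
      suc (blockStart x (i + length w))         ∎

  letter-before-block : ∀ p j → suc p ≡ blockStart x j → ∃ λ i → j ≡ suc i × y p ≡ σ (x i)
  letter-before-block p (suc i) 1+p≡ = i , refl , block-last (y≡Ψx i) 1+p≡

  left-extend : ∀ {i ys} → OccursAt y (blockStart x (suc i)) ys → Lext y ys (σ (x i))
  left-extend {i} {ys} o with blockStart-suc-pred x i
  ... | p , 1+p≡ = p , block-last (y≡Ψx i) 1+p≡ , subst (λ q → OccursAt y q ys) (sym 1+p≡) o

  right-extend : ∀ w {i d} → OccursAt x i (w ++ [ d ]) → OccursAt y (blockStart x i) (H w ++ [ σ d ])
  right-extend w {i} {d} o with OccursAt-++⁻ x w [ d ] i o
  ... | ow , (refl , _) = OccursAt-++⁺ y (H w) [ σ d ] (blockStart x i) (H-occurs w ow) (letter-after-H w ow , tt)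

  right-restrict : ∀ w {q f} → OccursAt y q (H w ++ [ f ]) →
    ∃ λ i → ∃ λ d → q ≡ blockStart x i × σ d ≡ f × OccursAt x i (w ++ [ d ])
  right-restrict w {q} {f} o with OccursAt-++⁻ y (H w) [ f ] q o
  ... | oH , (yf , _) with H-occurs⁻ w oH
  ...   | i , refl , ow = i , x (i + length w) , refl , trans (sym (letter-after-H w ow)) yf ,
                          OccursAt-++⁺ x w [ x (i + length w) ] i ow (refl , tt)

  Lext-card : ∀ w {n m} → HasCard (Lext x w) n → HasCard (Lext y (H w)) m → n ≡ m
  Lext-card w = HasCard-injective-image σ σ-injective extend restrict
    where
    extend : ∀ {c} → Lext x w c → Lext y (H w) (σ c)
    extend (i , refl , o) = left-extend (H-occurs w o)
    restrict : ∀ {f} → Lext y (H w) f → ∃ λ c → σ c ≡ f × Lext x w c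
    restrict (p , refl , o) with H-occurs⁻ w o
    ... | j , 1+p≡ , ow with letter-before-block p j 1+p≡
    ...   | i , refl , yp≡ = x i , sym yp≡ , i , refl , ow

  Rext-card : ∀ w {n m} → HasCard (Rext x w) n → HasCard (Rext y (H w)) m → n ≡ m
  Rext-card w = HasCard-injective-image σ σ-injective extend restrict
    where
    extend : ∀ {d} → Rext x w d → Rext y (H w) (σ d)
    extend (i , o) = blockStart x i , right-extend w o
    restrict : ∀ {f} → Rext y (H w) f → ∃ λ d → σ d ≡ f × Rext x w d
    restrict (q , o) with right-restrict w o
    ... | i , d , _ , σd≡f , o′ = d , σd≡f , i , o′

  BiExt-card : ∀ w {n m} → HasCard (BiExt x w) n → HasCard (BiExt y (H w)) m → n ≡ m
  BiExt-card w = HasCard-injective-image (Product.map σ σ) σ×σ-injective extend restrict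
    where
    extend : ∀ {cd} → BiExt x w cd → BiExt y (H w) (Product.map σ σ cd)
    extend {c , d} (i , refl , o) = left-extend (right-extend w o)
    restrict : ∀ {ef} → BiExt y (H w) ef → ∃ λ cd → Product.map σ σ cd ≡ ef × BiExt x w cd
    restrict {e , f} (p , refl , o) with right-restrict w o
    ... | j , d , 1+p≡ , σd≡f , o′ with letter-before-block p j 1+p≡
    ...   | i , refl , yp≡ = (x i , d) , cong₂ _,_ (sym yp≡) σd≡f , i , refl , o′

  bilateralOrder-H : ∀ w {k k′} → BilateralOrder x w k → BilateralOrder y (H w) k′ → k ≡ k′
  bilateralOrder-H w (_ , _ , _ , cB , cL , cR , refl) (_ , _ , _ , cB′ , cL′ , cR′ , refl)
    with BiExt-card w cB cB′ | Lext-card w cL cL′ | Rext-card w cR cR′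
  ... | refl | refl | refl = refl

open ΨImage v-IsΨImage-u

-- For a non-factor w all extension sets on both sides are empty, so (c) needs no factor hypothesis.
lemma6 : (w : List AB) →
    (Factor u w → Factor v (H w)) ×
    (Palindrome w → Palindrome (H w)) ×
    (Factor u w → (k k′ : ℤ) → BilateralOrder u w k → BilateralOrder v (H w) k′ → k ≡ k′)
lemma6 w =
  (λ (i , o) → blockStart u i , H-occurs w o) ,
  H-palindrome w ,
  λ _ _ _ → bilateralOrder-H w
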